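{- Let $p$ be a prime with $p\nmid\mathrm{Vol}(\Delta)$ and $p>(n+4)D$. Let $\ell,m\ge1$ and let $\mathbb S_1,\dots,\mathbb S_m$ be $\ell$-element subsets of $\mathbb M(\Delta)$, with multiset union $\mathbb S^\star=\biguplus_{j}\mathbb S_j\in\mathscr M_\ell(m)$. Then the following are equivalent: (1) $h(\mathbb S^\star)=\min\{h(\mathbb S'^\star):\mathbb S'^\star\in\mathscr M_\ell(m)\}$; (2) for each $i$, $\sum_{Q\in\mathbb S_i}w(Q)=\min\{\sum_{Q\in\mathbb S'}w(Q):\mathbb S'\subset\mathbb M(\Delta),\ \#\mathbb S'=\ell\}$.
   Context: Fix $n\ge1$ and linearly independent $\mathbf V_1,\dots,\mathbf V_n\in\mathbb Z^n$; $\Delta=\{\sum_iz_i\mathbf V_i:0\le z_i\le1\}$ with Euclidean volume $\mathrm{Vol}(\Delta)$; $\mathbb M(\Delta)=\{\sum_iz_i\mathbf V_i:z_i\ge0\}\cap\mathbb Z^n$; weight $w(\sum_iz_i\mathbf V_i)=\max_iz_i$. $D$ is the smallest positive integer with all coordinates $z_i$ of all elements of $\mathbb M(\Delta)$ in $\frac1D\mathbb Z_{\ge0}$. For a finite multiset $\mathbb S^\star$ of elements of $\mathbb M(\Delta)$, $h(\mathbb S^\star)=\sum_{Q\in\mathbb S^\star}(\lfloor w(pQ)\rfloor-\lfloor w(Q)\rfloor)$ counted with multiplicity. $\mathscr M_\ell(m)$ is the set of sub-multisets of cardinality $m\ell$ of the multiset consisting of $m$ copies of $\mathbb M(\Delta)$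 (i.e. finite multisets of elements of $\mathbb M(\Delta)$ of total size $m\ell$ with each multiplicity at most $m$). -}

module Defs where

open import Data.Nat as ℕ using (ℕ; zero; suc)
open import Data.Integer as ℤ using (ℤ; +_; ∣_∣)
open import Data.Rational as ℚ using (ℚ; 0ℚ; floor; _/_)
open import Data.Rational.Properties using () renaming (_≟_ to _≟ℚ_)
open import Data.Fin using (Fin; toℕ)
open import Data.Vec as Vec using (Vec; []; _∷_; lookup; removeAt; allFin; replicate; zipWith)
open import Data.Vec.Properties using (≡-dec)
import Data.Vec.Relation.Unary.All as VAll
open import Data.List as List using (List; length; filter)
import Data.List.Relation.Unary.All as LAll
open import Data.List.Relation.Unary.Unique.Propositional using (Unique)
open import Data.Product using (Σ; _×_; ∃)
open import Relation.Binary.PropositionalEquality using (_≡_)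

ι : ℤ → ℚ
ι a = a / 1

lincomb : ∀ {n k} → Vec ℚ k → Vec (Vec ℤ n) k → Vec ℚ n
lincomb {n} [] [] = replicate n 0ℚ
lincomb (c ∷ cs) (v ∷ vs) = zipWith ℚ._+_ (Vec.map (λ a → c ℚ.* ι a) v) (lincomb cs vs)

LinIndep : ∀ {n} → Vec (Vec ℤ n) n → Set
LinIndep {n} V = ∀ (c : Vec ℚ n) → lincomb c V ≡ replicate n 0ℚ → c ≡ replicate n 0ℚ

sumℤ : ∀ {k} → Vec ℤ k → ℤ
sumℤ = Vec.foldr _ ℤ._+_ (+ 0)

sign : ℕ → ℤ
sign zero = + 1
sign (suc i) = ℤ.- sign i

det : ∀ {n} → Vec (Vec ℤ n) n → ℤ
det {zero} [] = + 1
det {suc n} rows =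
  sumℤ (Vec.map (λ i → sign (toℕ i) ℤ.* (Vec.head (lookup rows i) ℤ.* det (Vec.map Vec.tail (removeAt rows i)))) (allFin (suc n)))

-- Euclidean volume of the parallelepiped Δ spanned by V_1..V_n
Vol : ∀ {n} → Vec (Vec ℤ n) n → ℕ
Vol V = ∣ det V ∣

IsInt : ℚ → Set
IsInt q = ∃ λ (k : ℤ) → q ≡ ι k

-- Elements of 𝕄(Δ) are represented by their coordinate vector z = (z_1..z_n)
-- w.r.t. V (a bijection, by linear independence): z_i ≥ 0 and Σ z_i V_i ∈ ℤ^n.
InM : ∀ {n} → Vec (Vec ℤ n) n → Vec ℚ n → Set
InM V z = VAll.All (λ q → 0ℚ ℚ.≤ q) z × VAll.All IsInt (lincomb z V)

-- weight w(Q) = max_i z_i  (coordinates are ≥ 0, so folding max from 0 is the max)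
w : ∀ {n} → Vec ℚ n → ℚ
w = Vec.foldr _ ℚ._⊔_ 0ℚ

DenomProp : ∀ {n} → Vec (Vec ℤ n) n → ℕ → Set
DenomProp V d = ∀ z → InM V z → VAll.All (λ q → IsInt (ι (+ d) ℚ.* q)) z

IsD : ∀ {n} → Vec (Vec ℤ n) n → ℕ → Set
IsD V D = (0 ℕ.< D) × DenomProp V D × (∀ d → 0 ℕ.< d → DenomProp V d → D ℕ.≤ d)

-- finite multisets are lists (all quantities below are permutation invariant)
count : ∀ {n} → Vec ℚ n → List (Vec ℚ n) → ℕ
count z S = length (filter (λ Q → ≡-dec _≟ℚ_ z Q) S)

-- h(𝕊*) = Σ_Q (⌊w(pQ)⌋ - ⌊w(Q)⌋); pQ has coordinates p·z
h : ∀ {n} → ℕ → List (Vec ℚ n) → ℤ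
h p S = List.foldr (λ Q acc → (floor (w (Vec.map (λ q → ι (+ p) ℚ.* q) Q)) ℤ.- floor (w Q)) ℤ.+ acc) (+ 0) S

wsum : ∀ {n} → List (Vec ℚ n) → ℚ
wsum S = List.foldr (λ Q acc → w Q ℚ.+ acc) 0ℚ S

IsSubsetℓ : ∀ {n} → Vec (Vec ℤ n) n → ℕ → List (Vec ℚ n) → Set
IsSubsetℓ V ℓ S = Unique S × length S ≡ ℓ × LAll.All (InM V) S

InMℓm : ∀ {n} → Vec (Vec ℤ n) n → ℕ → ℕ → List (Vec ℚ n) → Set
InMℓm V ℓ m S = length S ≡ m ℕ.* ℓ × LAll.All (InM V) S × (∀ Q → count Q S ℕ.≤ m)

MinH : ∀ {n} → Vec (Vec ℤ n) n → ℕ → ℕ → ℕ → List (Vec ℚ n) → Set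
MinH V ℓ m p S = ∀ S' → InMℓm V ℓ m S' → h p S ℤ.≤ h p S'

MinW : ∀ {n} → Vec (Vec ℤ n) n → ℕ → List (Vec ℚ n) → Set
MinW V ℓ S = ∀ S' → IsSubsetℓ V ℓ S' → wsum S ℚ.≤ wsum S'

⊎S : ∀ {n m} → Vec (List (Vec ℚ n)) m → List (Vec ℚ n)
⊎S S = List.concat (Vec.toList S)

{-# OPTIONS --safe #-}
-- The summand of h at Q is φ (w Q) with φ u = ⌊p u⌋ − ⌊u⌋. Weights of points of 𝕄(Δ) lie in
-- (1/D)ℤ, so distinct weights differ by at least 1/D, and then (p − 1)(v − u) ≥ 2 absorbs both
-- rounding errors: φ is strictly increasing on the weights that occur. So both conditions say
-- that the chosen points are the lightest ones available, and each direction is an exchange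
-- argument: swapping a heavier chosen point for a lighter unchosen one would lower the sum, and
-- conversely two lists of equal length are compared by matching every element of the second
-- with an element of the first that is no heavier.

module Submission where

open import Defs hiding (count)
open import Data.Nat using (ℕ; _+_; _*_; _<_; _≤_)
open import Data.Nat.Divisibility using (_∣_)
open import Data.Nat.Primality using (Prime)
open import Data.Integer using (ℤ)
open import Data.Rational using (ℚ)
open import Data.Fin using (Fin)
open import Data.Vec using (Vec; lookup)
open import Data.List using (List)
open import Relation.Nullary using (¬_)
open import Function.Bundles using (_⇔_; mk⇔)

open import Data.Nat as ℕ using (zero; suc; s≤s; z≤n)
import Data.Nat.Properties as ℕP
open import Data.Fin using (zero; suc)
open import Data.Vec as Vec using ([]; _∷_; toList)
open import Data.Vec.Membership.Propositional.Properties using (∈-lookup; ∈-toList⁺)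
import Data.Vec.Relation.Unary.All as VAll
open import Data.Vec.Properties using (≡-dec)
open import Data.Integer as ℤ using (+_)
import Data.Integer.Properties as ℤP
open import Data.Integer.DivMod using ([n/d]*d≤n; n<s[n/ℕd]*d; div-pos-is-/ℕ)
open import Data.Integer.GCD using (gcd; gcd-zeroʳ)
import Data.Integer.Solver as ℤSolver
open import Data.Nat.Coprimality using (1-coprimeTo) renaming (sym to coprime-sym)
open import Data.Rational as ℚ using (mkℚ; 0ℚ; 1ℚ; floor; _/_; ↥_; ↧_)
import Data.Rational.Properties as ℚP
open import Data.Rational.Properties using () renaming (_≟_ to _≟ℚ_)
import Data.Rational.Solver as ℚSolver
open import Data.List as List using ([]; _∷_; [_]; length; filter; _++_; concat)
import Data.List.Properties as ListP
open import Data.List.Relation.Unary.Any using (here; there)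
open import Data.List.Relation.Unary.All as All using (All; []; _∷_)
open import Data.List.Relation.Unary.All.Properties using (¬All⇒Any¬; All¬⇒¬Any; ++⁺)
open import Data.List.Relation.Unary.Unique.Propositional using (Unique; []; _∷_)
open import Data.List.Membership.Propositional using (_∈_; _∉_; find)
open import Data.List.Membership.Propositional.Properties using (∈-++⁻; ∈-concat⁺′)
open import Data.List.Relation.Binary.Permutation.Propositional
  using (_↭_; refl; prep; swap; trans; ↭-refl; ↭-sym)
open import Data.List.Relation.Binary.Permutation.Propositional.Properties
  using (↭-length; filter-↭; Any-resp-↭; All-resp-↭)
open import Data.Product using (∃; _×_; _,_; proj₁; proj₂)
open import Data.Sum using (inj₁; inj₂)
open import Data.Empty using (⊥-elim)
open import Function using (_∘_)
open import Level using (_⊔_)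
open import Algebra.Bundles using (CommutativeSemigroup)
open import Algebra.Core using (Op₂)
open import Algebra.Structures using (IsCommutativeMonoid)
open import Relation.Binary.Core using (Rel; _Preserves₂_⟶_⟶_)
open import Relation.Binary.Definitions using (DecidableEquality; Reflexive)
open import Relation.Binary.PropositionalEquality
  using (_≡_; _≢_; refl; sym; cong; cong₂; subst; subst₂; module ≡-Reasoning)
  renaming (trans to ≡-trans)
open import Relation.Nullary using (yes; no; contradiction)

module Multiplicity {a} {A : Set a} (_≟_ : DecidableEquality A) where

  open import Data.List.Membership.DecPropositional _≟_ public using (_∈?_)

  -- At A = Vec ℚ n and _≟_ = ≡-dec _≟ℚ_ this is definitionally Defs.count.
  count : A → List A → ℕ
  count x xs = length (filter (x ≟_) xs)

  count-++ : ∀ x xs ys → count x (xs ++ ys) ≡ count x xs + count x ys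
  count-++ x xs ys = ≡-trans (cong length (ListP.filter-++ (x ≟_) xs ys)) (ListP.length-++ (filter (x ≟_) xs))

  count-∷ : ∀ x y xs → count x (y ∷ xs) ≡ count x [ y ] + count x xs
  count-∷ x y = count-++ x [ y ]

  count-∷-≡ : ∀ x xs → count x (x ∷ xs) ≡ suc (count x xs)
  count-∷-≡ x xs with x ≟ x
  ... | yes _  = refl
  ... | no x≢x = contradiction refl x≢x

  count-∷-≢ : ∀ {x y} xs → x ≢ y → count x (y ∷ xs) ≡ count x xs
  count-∷-≢ {x} {y} xs x≢y with x ≟ y
  ... | yes x≡y = contradiction x≡y x≢y
  ... | no _    = refl

  count-≤-∷ : ∀ x y ys → count x ys ≤ count x (y ∷ ys)
  count-≤-∷ x y ys = subst (count x ys ≤_) (sym (count-∷ x y ys)) (ℕP.m≤n+m _ (count x [ y ]))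

  ∈⇒0<count : ∀ {x xs} → x ∈ xs → 0 < count x xs
  ∈⇒0<count {x} {_ ∷ xs} (here refl)  rewrite count-∷-≡ x xs = s≤s z≤n
  ∈⇒0<count {x} {y ∷ xs} (there x∈xs) = ℕP.<-≤-trans (∈⇒0<count x∈xs) (count-≤-∷ x y xs)

  0<count⇒∈ : ∀ {x xs} → 0 < count x xs → x ∈ xs
  0<count⇒∈ {x} {y ∷ xs} 0<count with x ≟ y
  ... | yes x≡y = here x≡y
  ... | no _ = there (0<count⇒∈ 0<count)

  ∉⇒count≡0 : ∀ {x xs} → x ∉ xs → count x xs ≡ 0
  ∉⇒count≡0 x∉xs = ℕP.n≤0⇒n≡0 (ℕP.≮⇒≥ (x∉xs ∘ 0<count⇒∈))

  Unique⇒count≤1 : ∀ {xs} → Unique xs → ∀ x → count x xs ≤ 1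
  Unique⇒count≤1 [] x = z≤n
  Unique⇒count≤1 {y ∷ xs} (y∉xs ∷ u) x with x ≟ y
  ... | yes refl = s≤s (ℕP.≤-reflexive (∉⇒count≡0 (All¬⇒¬Any y∉xs)))
  ... | no _ = Unique⇒count≤1 u x

  remove : A → List A → List A
  remove x []       = []
  remove x (y ∷ ys) with x ≟ y
  ... | yes _ = ys
  ... | no _  = y ∷ remove x ys

  remove-↭ : ∀ {x xs} → x ∈ xs → x ∷ remove x xs ↭ xs
  remove-↭ {x} {y ∷ ys} x∈ with x ≟ y
  remove-↭ {x} {y ∷ ys} x∈          | yes refl = ↭-refl
  remove-↭ {x} {y ∷ ys} (here x≡y)  | no x≢y   = contradiction x≡y x≢y
  remove-↭ {x} {y ∷ ys} (there x∈ys) | no _     = trans (swap x y refl) (prep y (remove-↭ x∈ys))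

  length-remove : ∀ {x xs} → x ∈ xs → suc (length (remove x xs)) ≡ length xs
  length-remove x∈xs = ↭-length (remove-↭ x∈xs)

  count-remove : ∀ {x xs} → x ∈ xs → ∀ y → count y (x ∷ remove x xs) ≡ count y xs
  count-remove x∈xs y = ↭-length (filter-↭ (y ≟_) (remove-↭ x∈xs))

  count-remove-≡ : ∀ {x xs} → x ∈ xs → count x xs ≡ suc (count x (remove x xs))
  count-remove-≡ {x} {xs} x∈xs = ≡-trans (sym (count-remove x∈xs x)) (count-∷-≡ x (remove x xs))

  count-remove-≢ : ∀ {x xs z} → x ∈ xs → z ≢ x → count z xs ≡ count z (remove x xs)
  count-remove-≢ {x} {xs} x∈xs z≢x = ≡-trans (sym (count-remove x∈xs _)) (count-∷-≢ (remove x xs) z≢x)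

  count-remove-≤ : ∀ {x xs} → x ∈ xs → ∀ y → count y (remove x xs) ≤ count y xs
  count-remove-≤ {x} {xs} x∈xs y =
    subst (count y (remove x xs) ≤_) (count-remove x∈xs y) (count-≤-∷ y x (remove x xs))

  ∈-remove⁻ : ∀ {x y xs} → x ∈ xs → y ∈ remove x xs → y ∈ xs
  ∈-remove⁻ x∈xs y∈ = Any-resp-↭ (remove-↭ x∈xs) (there y∈)

  ∈-remove⁺ : ∀ {x y xs} → x ∈ xs → y ≢ x → y ∈ xs → y ∈ remove x xs
  ∈-remove⁺ x∈xs y≢x y∈xs with Any-resp-↭ (↭-sym (remove-↭ x∈xs)) y∈xs
  ... | here y≡x = contradiction y≡x y≢x
  ... | there y∈ = y∈

  All-remove : ∀ {p} {P : A → Set p} {x xs} → x ∈ xs → All P xs → All P (remove x xs)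
  All-remove x∈xs pxs = All.tail (All-resp-↭ (↭-sym (remove-↭ x∈xs)) pxs)

  Unique-remove : ∀ {x xs} → x ∈ xs → Unique xs → Unique (remove x xs)
  Unique-remove {x} {y ∷ ys} x∈ (y∉ys ∷ u) with x ≟ y
  Unique-remove {x} {y ∷ ys} x∈          (y∉ys ∷ u) | yes _    = u
  Unique-remove {x} {y ∷ ys} (here x≡y)  (y∉ys ∷ u) | no x≢y   = contradiction x≡y x≢y
  Unique-remove {x} {y ∷ ys} (there x∈ys) (y∉ys ∷ u) | no _    = All-remove x∈ys y∉ys ∷ Unique-remove x∈ys u

  _⊑_ : List A → List A → Set a
  xs ⊑ ys = ∀ {x} → x ∈ xs → count x xs ≤ count x ys

  ⊑-∉⇒length-< : ∀ xs {ys} → xs ⊑ ys → ∀ {y} → y ∈ ys → y ∉ xs → length xs < length ys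
  ⊑-∉⇒length-< []       {[]}    _   ()   _
  ⊑-∉⇒length-< []       {_ ∷ _} _   _    _   = s≤s z≤n
  ⊑-∉⇒length-< (x ∷ xs) {ys}    sub y∈ys y∉ =
    subst (suc (length xs) <_) (length-remove x∈ys)
      (s≤s (⊑-∉⇒length-< xs sub′ (∈-remove⁺ x∈ys (y∉ ∘ here) y∈ys) (y∉ ∘ there)))
    where
    x∈ys : x ∈ ys
    x∈ys = 0<count⇒∈ (ℕP.<-≤-trans (∈⇒0<count (here refl)) (sub (here refl)))
    sub′ : xs ⊑ remove x ys
    sub′ {z} z∈xs = ℕP.+-cancelˡ-≤ (count z [ x ]) _ _ (subst₂ _≤_ (count-∷ z x xs)
      (≡-trans (sym (count-remove x∈ys z)) (count-∷ z x (remove x ys))) (sub (there z∈xs)))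

  surplus : ∀ xs ys → length xs ≡ length ys → ∀ {y} → y ∈ ys → y ∉ xs →
            ∃ λ x → x ∈ xs × count x ys < count x xs
  surplus xs ys eq y∈ys y∉xs with All.all? (λ x → count x xs ℕP.≤? count x ys) xs
  ... | yes xs⊑ys = contradiction eq (ℕP.<⇒≢ (⊑-∉⇒length-< xs (All.lookup xs⊑ys) y∈ys y∉xs))
  ... | no xs⋢ys with x , x∈xs , x≰ ← find (¬All⇒Any¬ (λ x → count x xs ℕP.≤? count x ys) xs xs⋢ys) =
    x , x∈xs , ℕP.≰⇒> x≰

  module Exchange {c ℓ} {C : Set c} {_⊕_ : Op₂ C} {ε : C} (isCM : IsCommutativeMonoid _≡_ _⊕_ ε)
                  (_≼_ : Rel C ℓ) (≼-refl : Reflexive _≼_)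
                  (⊕-mono-≼ : _⊕_ Preserves₂ _≼_ ⟶ _≼_ ⟶ _≼_) (g : A → C) where

    ⊕-commutativeSemigroup : CommutativeSemigroup c c
    ⊕-commutativeSemigroup = record
      { isCommutativeSemigroup = IsCommutativeMonoid.isCommutativeSemigroup isCM }

    open import Algebra.Properties.CommutativeSemigroup ⊕-commutativeSemigroup using (x∙yz≈y∙xz)

    sumOf : List A → C
    sumOf = List.foldr (λ x acc → g x ⊕ acc) ε

    sumOf-↭ : ∀ {xs ys} → xs ↭ ys → sumOf xs ≡ sumOf ys
    sumOf-↭ refl          = refl
    sumOf-↭ (prep x p)    = cong (g x ⊕_) (sumOf-↭ p)
    sumOf-↭ (swap x y p)  = ≡-trans (x∙yz≈y∙xz (g x) (g y) _) (cong (λ s → g y ⊕ (g x ⊕ s)) (sumOf-↭ p))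
    sumOf-↭ (trans p q)   = ≡-trans (sumOf-↭ p) (sumOf-↭ q)

    sumOf-remove : ∀ {x xs} → x ∈ xs → g x ⊕ sumOf (remove x xs) ≡ sumOf xs
    sumOf-remove x∈xs = sumOf-↭ (remove-↭ x∈xs)

    SurplusDominates : List A → List A → Set (a ⊔ ℓ)
    SurplusDominates xs ys = ∀ {x y} → x ∈ xs → y ∈ ys → count y xs < count y ys → g x ≼ g y

    -- y is matched with itself if it occurs in xs, and otherwise with an element of which
    -- xs has more copies than y ∷ ys.
    SurplusDominates-step : ∀ xs {y ys} → length xs ≡ length (y ∷ ys) → SurplusDominates xs (y ∷ ys) →
                            ∃ λ x → x ∈ xs × g x ≼ g y × SurplusDominates (remove x xs) ys
    SurplusDominates-step xs {y} {ys} eq dom with y ∈? xs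
    ... | yes y∈xs = y , y∈xs , ≼-refl , λ x∈ z∈ lt → dom (∈-remove⁻ y∈xs x∈) (there z∈) (shared lt)
      where
      shared : ∀ {z} → count z (remove y xs) < count z ys → count z xs < count z (y ∷ ys)
      shared {z} lt rewrite sym (count-remove y∈xs z) | count-∷ z y (remove y xs) | count-∷ z y ys =
        ℕP.+-monoʳ-< (count z [ y ]) lt
    ... | no y∉xs with x , x∈xs , x-excess ← surplus xs (y ∷ ys) eq (here refl) y∉xs =
      x , x∈xs , dom x∈xs (here refl) y-short , λ x′∈ z∈ lt → dom (∈-remove⁻ x∈xs x′∈) (there z∈) (excess lt)
      where
      y-short : count y xs < count y (y ∷ ys)
      y-short rewrite ∉⇒count≡0 y∉xs = ∈⇒0<count (here refl)
      excess : ∀ {z} → count z (remove x xs) < count z ys → count z xs < count z (y ∷ ys)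
      excess {z} lt with z ≟ x
      ... | yes refl = contradiction (ℕ.s≤s⁻¹ (subst (count z (y ∷ ys) <_) (count-remove-≡ x∈xs) x-excess))
                                     (ℕP.<⇒≱ (ℕP.<-≤-trans lt (count-≤-∷ z y ys)))
      ... | no z≢x   =
        ℕP.<-≤-trans (subst (_< count z ys) (sym (count-remove-≢ x∈xs z≢x)) lt) (count-≤-∷ z y ys)

    sumOf-≼ : ∀ xs ys → length xs ≡ length ys → SurplusDominates xs ys → sumOf xs ≼ sumOf ys
    sumOf-≼ []      []       _  _   = ≼-refl
    sumOf-≼ (_ ∷ _) []       () _
    sumOf-≼ xs      (y ∷ ys) eq dom with x , x∈xs , gx≼gy , dom′ ← SurplusDominates-step xs eq dom =
      subst (_≼ sumOf (y ∷ ys)) (sumOf-remove x∈xs)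
        (⊕-mono-≼ gx≼gy (sumOf-≼ (remove x xs) ys (ℕP.suc-injective (≡-trans (length-remove x∈xs) eq)) dom′))

  ∈-concat-toList⁻ : ∀ {m} (xss : Vec (List A) m) {x} → x ∈ concat (toList xss) → ∃ λ j → x ∈ lookup xss j
  ∈-concat-toList⁻ (xs ∷ xss) x∈ with ∈-++⁻ xs x∈
  ... | inj₁ x∈xs = zero , x∈xs
  ... | inj₂ x∈rest with j , x∈xss[j] ← ∈-concat-toList⁻ xss x∈rest = suc j , x∈xss[j]

  ∈-concat-toList⁺ : ∀ {m} (xss : Vec (List A) m) j {x} → x ∈ lookup xss j → x ∈ concat (toList xss)
  ∈-concat-toList⁺ xss j x∈ = ∈-concat⁺′ x∈ (∈-toList⁺ (∈-lookup j xss))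

  length-concat-toList : ∀ {m ℓ} (xss : Vec (List A) m) → (∀ j → length (lookup xss j) ≡ ℓ) →
                         length (concat (toList xss)) ≡ m * ℓ
  length-concat-toList []         _   = refl
  length-concat-toList (xs ∷ xss) len =
    ≡-trans (ListP.length-++ xs) (cong₂ _+_ (len zero) (length-concat-toList xss (len ∘ suc)))

  All-concat-toList : ∀ {p} {P : A → Set p} {m} (xss : Vec (List A) m) → (∀ j → All P (lookup xss j)) →
                      All P (concat (toList xss))
  All-concat-toList []         _   = []
  All-concat-toList (xs ∷ xss) all = ++⁺ (all zero) (All-concat-toList xss (all ∘ suc))

  count-concat-toList-≤ : ∀ {m} (xss : Vec (List A) m) → (∀ j → Unique (lookup xss j)) →
                          ∀ y → count y (concat (toList xss)) ≤ m
  count-concat-toList-≤ []         _ y = z≤n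
  count-concat-toList-≤ (xs ∷ xss) u y rewrite count-++ y xs (concat (toList xss)) =
    ℕP.+-mono-≤ (Unique⇒count≤1 (u zero) y) (count-concat-toList-≤ xss (u ∘ suc) y)

  count-concat-toList-∉ : ∀ {m} (xss : Vec (List A) m) → (∀ j → Unique (lookup xss j)) →
                          ∀ {y} i → y ∉ lookup xss i → count y (concat (toList xss)) < m
  count-concat-toList-∉ (xs ∷ xss) u {y} zero y∉ rewrite count-++ y xs (concat (toList xss)) | ∉⇒count≡0 y∉ =
    s≤s (count-concat-toList-≤ xss (u ∘ suc) y)
  count-concat-toList-∉ (xs ∷ xss) u {y} (suc i) y∉ rewrite count-++ y xs (concat (toList xss)) =
    ℕP.+-mono-≤-< (Unique⇒count≤1 (u zero) y) (count-concat-toList-∉ xss (u ∘ suc) i y∉)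

  count-concat-toList-<⇒∉ : ∀ {m} (xss : Vec (List A) m) y → count y (concat (toList xss)) < m →
                            ∃ λ i → y ∉ lookup xss i
  count-concat-toList-<⇒∉ (xs ∷ xss) y lt rewrite count-++ y xs (concat (toList xss)) with y ∈? xs
  ... | no y∉xs  = zero , y∉xs
  ... | yes y∈xs with i , y∉ ← count-concat-toList-<⇒∉ xss y
                     (ℕP.<-≤-trans (ℕP.+-monoˡ-≤ _ (∈⇒0<count y∈xs)) (ℕ.s≤s⁻¹ lt)) = suc i , y∉

↥-ι : ∀ a → ↥ (ι a) ≡ a
↥-ι a = begin
  ↥ (ι a)                   ≡⟨ sym (ℤP.*-identityʳ _) ⟩
  ↥ (ι a) ℤ.* + 1           ≡⟨ cong (↥ (ι a) ℤ.*_) (sym (gcd-zeroʳ a)) ⟩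
  ↥ (ι a) ℤ.* gcd a (+ 1) ≡⟨ ℚP.↥-/ a 1 ⟩
  a                         ∎
  where open ≡-Reasoning

↧-ι : ∀ a → ↧ (ι a) ≡ + 1
↧-ι a = begin
  ↧ (ι a)                   ≡⟨ sym (ℤP.*-identityʳ _) ⟩
  ↧ (ι a) ℤ.* + 1           ≡⟨ cong (↧ (ι a) ℤ.*_) (sym (gcd-zeroʳ a)) ⟩
  ↧ (ι a) ℤ.* gcd a (+ 1) ≡⟨ ℚP.↧-/ a 1 ⟩
  + 1                       ∎
  where open ≡-Reasoning

ι≡mkℚ : ∀ a → ι a ≡ mkℚ a 0 (coprime-sym (1-coprimeTo _))
ι≡mkℚ a = ℚP.≃⇒≡ (ℚ.*≡* (cong₂ ℤ._*_ (↥-ι a) (sym (↧-ι a))))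

ι-+ : ∀ a b → ι a ℚ.+ ι b ≡ ι (a ℤ.+ b)
ι-+ a b rewrite ι≡mkℚ a | ι≡mkℚ b = cong (_/ 1) (cong₂ ℤ._+_ (ℤP.*-identityʳ a) (ℤP.*-identityʳ b))

ι-* : ∀ a b → ι a ℚ.* ι b ≡ ι (a ℤ.* b)
ι-* a b rewrite ι≡mkℚ a | ι≡mkℚ b = refl

ι-mono-≤ : ∀ {a b} → a ℤ.≤ b → ι a ℚ.≤ ι b
ι-mono-≤ {a} {b} a≤b rewrite ι≡mkℚ a | ι≡mkℚ b = ℚ.*≤* (ℤP.*-monoʳ-≤-nonNeg (+ 1) a≤b)

ι-mono-< : ∀ {a b} → a ℤ.< b → ι a ℚ.< ι b
ι-mono-< {a} {b} a<b rewrite ι≡mkℚ a | ι≡mkℚ b = ℚ.*<* (ℤP.*-monoʳ-<-pos (+ 1) a<b)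

ι-cancel-< : ∀ {a b} → ι a ℚ.< ι b → a ℤ.< b
ι-cancel-< {a} {b} lt rewrite ι≡mkℚ a | ι≡mkℚ b =
  subst₂ ℤ._<_ (ℤP.*-identityʳ a) (ℤP.*-identityʳ b) (ℚP.drop-*<* lt)

floor-≤ : ∀ q → ι (floor q) ℚ.≤ q
floor-≤ q@(mkℚ n d _) rewrite ι≡mkℚ (floor q) =
  ℚ.*≤* (subst (floor q ℤ.* + suc d ℤ.≤_) (sym (ℤP.*-identityʳ n)) ([n/d]*d≤n n (+ suc d)))

<-floor+1 : ∀ q → q ℚ.< ι (floor q ℤ.+ + 1)
<-floor+1 q@(mkℚ n d _) rewrite ι≡mkℚ (floor q ℤ.+ + 1) =
  ℚ.*<* (subst₂ ℤ._<_ (sym (ℤP.*-identityʳ n)) (cong (ℤ._* + suc d) floor+1≡) (n<s[n/ℕd]*d n (suc d)))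
  where
  floor+1≡ : ℤ.suc (n ℤ./ℕ suc d) ≡ floor q ℤ.+ + 1
  floor+1≡ = ≡-trans (ℤP.+-comm (+ 1) (n ℤ./ℕ suc d)) (cong (ℤ._+ + 1) (sym (div-pos-is-/ℕ n (suc d))))

floor-+-< : ∀ a b c d → (a ℚ.+ b) ℚ.+ ι (+ 2) ℚ.≤ c ℚ.+ d →
            (floor a ℤ.+ floor b) ℤ.+ + 2 ℤ.< (floor c ℤ.+ + 1) ℤ.+ (floor d ℤ.+ + 1)
floor-+-< a b c d ab+2≤cd = ι-cancel-< (begin-strict
  ι ((⌊a⌋ ℤ.+ ⌊b⌋) ℤ.+ + 2)             ≡⟨ sym (ι-+ (⌊a⌋ ℤ.+ ⌊b⌋) (+ 2)) ⟩
  ι (⌊a⌋ ℤ.+ ⌊b⌋) ℚ.+ ι (+ 2)           ≡⟨ cong (ℚ._+ ι (+ 2)) (sym (ι-+ ⌊a⌋ ⌊b⌋)) ⟩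
  (ι ⌊a⌋ ℚ.+ ι ⌊b⌋) ℚ.+ ι (+ 2)         ≤⟨ ℚP.+-monoˡ-≤ (ι (+ 2)) (ℚP.+-mono-≤ (floor-≤ a) (floor-≤ b)) ⟩
  (a ℚ.+ b) ℚ.+ ι (+ 2)                 ≤⟨ ab+2≤cd ⟩
  c ℚ.+ d                               <⟨ ℚP.+-mono-< (<-floor+1 c) (<-floor+1 d) ⟩
  ι (⌊c⌋ ℤ.+ + 1) ℚ.+ ι (⌊d⌋ ℤ.+ + 1)   ≡⟨ ι-+ (⌊c⌋ ℤ.+ + 1) (⌊d⌋ ℤ.+ + 1) ⟩
  ι ((⌊c⌋ ℤ.+ + 1) ℤ.+ (⌊d⌋ ℤ.+ + 1))   ∎)
  where
  open ℚP.≤-Reasoning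
  ⌊a⌋ ⌊b⌋ ⌊c⌋ ⌊d⌋ : ℤ
  ⌊a⌋ = floor a
  ⌊b⌋ = floor b
  ⌊c⌋ = floor c
  ⌊d⌋ = floor d

IsInt-<⇒1+≤ : ∀ {x y} → IsInt x → IsInt y → x ℚ.< y → 1ℚ ℚ.+ x ℚ.≤ y
IsInt-<⇒1+≤ (k , refl) (l , refl) k<l =
  subst (ℚ._≤ ι l) (sym (ι-+ (+ 1) k)) (ι-mono-≤ {+ 1 ℤ.+ k} {l} (ℤP.i<j⇒suc[i]≤j (ι-cancel-< {k} {l} k<l)))

-- D (v − u) ≥ 1 and 1 + 2D ≤ p give p (v − u) ≥ (v − u) + 2.
lattice-spread : ∀ {p D u v} → 0 ℕ.< D → 2 ℕ.* D ℕ.< p →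
                 IsInt (ι (+ D) ℚ.* u) → IsInt (ι (+ D) ℚ.* v) → u ℚ.< v →
                 (ι (+ p) ℚ.* u ℚ.+ v) ℚ.+ ι (+ 2) ℚ.≤ ι (+ p) ℚ.* v ℚ.+ u
lattice-spread {p} {D} {u} {v} 0<D 2D<p Du∈ℤ Dv∈ℤ u<v = begin
  (P ℚ.* u ℚ.+ v) ℚ.+ two
    ≡⟨ regroup P u v Dq two ⟩
  (P ℚ.* u ℚ.+ v ℚ.- two ℚ.* (Dq ℚ.* u)) ℚ.+ two ℚ.* (1ℚ ℚ.+ Dq ℚ.* u)
    ≤⟨ ℚP.+-monoʳ-≤ (P ℚ.* u ℚ.+ v ℚ.- two ℚ.* (Dq ℚ.* u)) (ℚP.*-monoˡ-≤-nonNeg two gap) ⟩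
  (P ℚ.* u ℚ.+ v ℚ.- two ℚ.* (Dq ℚ.* u)) ℚ.+ two ℚ.* (Dq ℚ.* v)
    ≡⟨ expand P u v Dq two ⟩
  (u ℚ.+ (1ℚ ℚ.+ two ℚ.* Dq) ℚ.* (v ℚ.- u)) ℚ.+ P ℚ.* u
    ≤⟨ ℚP.+-monoˡ-≤ (P ℚ.* u) (ℚP.+-monoʳ-≤ u (ℚP.*-monoʳ-≤-nonNeg (v ℚ.- u) 1+2D≤P)) ⟩
  (u ℚ.+ P ℚ.* (v ℚ.- u)) ℚ.+ P ℚ.* u
    ≡⟨ collect P u v ⟩
  P ℚ.* v ℚ.+ u
    ∎
  where
  open ℚP.≤-Reasoning
  open ℚSolver.+-*-Solver
  P Dq two : ℚ
  P   = ι (+ p)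
  Dq  = ι (+ D)
  two = ι (+ 2)
  instance
    Dq-positive : ℚ.Positive Dq
    Dq-positive = ℚ.positive (ι-mono-< (ℤ.+<+ 0<D))
    v-u-nonNegative : ℚ.NonNegative (v ℚ.- u)
    v-u-nonNegative = ℚ.nonNegative
      (subst (ℚ._≤ v ℚ.- u) (ℚP.+-inverseʳ u) (ℚP.+-monoˡ-≤ (ℚ.- u) (ℚP.<⇒≤ u<v)))
  gap : 1ℚ ℚ.+ Dq ℚ.* u ℚ.≤ Dq ℚ.* v
  gap = IsInt-<⇒1+≤ Du∈ℤ Dv∈ℤ (ℚP.*-monoʳ-<-pos Dq u<v)
  two*Dq≡ι2D : two ℚ.* Dq ≡ ι (+ (2 ℕ.* D))
  two*Dq≡ι2D = ≡-trans (ι-* (+ 2) (+ D)) (cong ι (sym (ℤP.pos-* 2 D)))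
  1+2D≤P : 1ℚ ℚ.+ two ℚ.* Dq ℚ.≤ P
  1+2D≤P = subst (ℚ._≤ P) (sym (≡-trans (cong (1ℚ ℚ.+_) two*Dq≡ι2D) (ι-+ (+ 1) (+ (2 ℕ.* D)))))
                 (ι-mono-≤ (ℤ.+≤+ 2D<p))
  regroup : ∀ P u v Dq two →
            (P ℚ.* u ℚ.+ v) ℚ.+ two ≡ (P ℚ.* u ℚ.+ v ℚ.- two ℚ.* (Dq ℚ.* u)) ℚ.+ two ℚ.* (1ℚ ℚ.+ Dq ℚ.* u)
  regroup = solve 5 (λ P u v Dq two → (P :* u :+ v) :+ two
                                    := (P :* u :+ v :- two :* (Dq :* u)) :+ two :* (con 1ℚ :+ Dq :* u)) refl
  expand : ∀ P u v Dq two → (P ℚ.* u ℚ.+ v ℚ.- two ℚ.* (Dq ℚ.* u)) ℚ.+ two ℚ.* (Dq ℚ.* v)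
                          ≡ (u ℚ.+ (1ℚ ℚ.+ two ℚ.* Dq) ℚ.* (v ℚ.- u)) ℚ.+ P ℚ.* u
  expand = solve 5 (λ P u v Dq two → (P :* u :+ v :- two :* (Dq :* u)) :+ two :* (Dq :* v)
                                   := (u :+ (con 1ℚ :+ two :* Dq) :* (v :- u)) :+ P :* u) refl
  collect : ∀ P u v → (u ℚ.+ P ℚ.* (v ℚ.- u)) ℚ.+ P ℚ.* u ≡ P ℚ.* v ℚ.+ u
  collect = solve 3 (λ P u v → (u :+ P :* (v :- u)) :+ P :* u := P :* v :+ u) refl

floorDiff : ℕ → ℚ → ℤ
floorDiff p u = floor (ι (+ p) ℚ.* u) ℤ.- floor u

floorDiff-mono-< : ∀ {p D u v} → 0 ℕ.< D → 2 ℕ.* D ℕ.< p →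
                   IsInt (ι (+ D) ℚ.* u) → IsInt (ι (+ D) ℚ.* v) → u ℚ.< v → floorDiff p u ℤ.< floorDiff p v
floorDiff-mono-< {p} {D} {u} {v} 0<D 2D<p Du∈ℤ Dv∈ℤ u<v =
  rearrange (floor (ι (+ p) ℚ.* u)) (floor v) (floor (ι (+ p) ℚ.* v)) (floor u)
    (floor-+-< (ι (+ p) ℚ.* u) v (ι (+ p) ℚ.* v) u (lattice-spread 0<D 2D<p Du∈ℤ Dv∈ℤ u<v))
  where
  open ℤSolver.+-*-Solver
  rearrange : ∀ a b c d → (a ℤ.+ b) ℤ.+ + 2 ℤ.< (c ℤ.+ + 1) ℤ.+ (d ℤ.+ + 1) → a ℤ.- d ℤ.< c ℤ.- b
  rearrange a b c d lt =
    subst₂ ℤ._<_ (shift-left a b d) (shift-right b c d) (ℤP.+-monoˡ-< (ℤ.- (b ℤ.+ d ℤ.+ + 2)) lt)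
    where
    shift-left : ∀ a b d → (a ℤ.+ b) ℤ.+ + 2 ℤ.- (b ℤ.+ d ℤ.+ + 2) ≡ a ℤ.- d
    shift-left = solve 3 (λ a b d → (a :+ b) :+ con (+ 2) :- (b :+ d :+ con (+ 2)) := a :- d) refl
    shift-right : ∀ b c d → (c ℤ.+ + 1) ℤ.+ (d ℤ.+ + 1) ℤ.- (b ℤ.+ d ℤ.+ + 2) ≡ c ℤ.- b
    shift-right = solve 3 (λ b c d → (c :+ con (+ 1)) :+ (d :+ con (+ 1)) :- (b :+ d :+ con (+ 2))
                                   := c :- b) refl

floorDiff-mono-≤ : ∀ {p D u v} → 0 ℕ.< D → 2 ℕ.* D ℕ.< p →
                   IsInt (ι (+ D) ℚ.* u) → IsInt (ι (+ D) ℚ.* v) → u ℚ.≤ v → floorDiff p u ℤ.≤ floorDiff p v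
floorDiff-mono-≤ {p} {D} {u} {v} 0<D 2D<p Du∈ℤ Dv∈ℤ u≤v with u ℚP.<? v
... | yes u<v = ℤP.<⇒≤ (floorDiff-mono-< 0<D 2D<p Du∈ℤ Dv∈ℤ u<v)
... | no u≮v  = ℤP.≤-reflexive (cong (floorDiff p) (ℚP.≤-antisym u≤v (ℚP.≮⇒≥ u≮v)))

w-map-* : ∀ {c} → 0ℚ ℚ.≤ c → ∀ {k} (Q : Vec ℚ k) → w (Vec.map (c ℚ.*_) Q) ≡ c ℚ.* w Q
w-map-* {c} 0≤c []      = sym (ℚP.*-zeroʳ c)
w-map-* {c} 0≤c (q ∷ Q) = ≡-trans (cong (c ℚ.* q ℚ.⊔_) (w-map-* 0≤c Q))
  (sym (ℚP.mono-≤-distrib-⊔ (ℚP.*-monoˡ-≤-nonNeg c {{ℚ.nonNegative 0≤c}}) q (w Q)))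

w-All : ∀ {ℓ} {P : ℚ → Set ℓ} → P 0ℚ → ∀ {k} {Q : Vec ℚ k} → VAll.All P Q → P (w Q)
w-All P0 VAll.[] = P0
w-All {P = P} P0 {Q = q ∷ Q} (Pq VAll.∷ PQ) with ℚP.⊔-sel q (w Q)
... | inj₁ w≡q = subst P (sym w≡q) Pq
... | inj₂ w≡wQ = subst P (sym w≡wQ) (w-All P0 PQ)

module _ {n} {V : Vec (Vec ℤ n) n} {D} (isD : IsD V D) {p} (2D<p : 2 ℕ.* D ℕ.< p) where

  open Multiplicity {A = Vec ℚ n} (≡-dec _≟ℚ_)

  contribution : Vec ℚ n → ℤ
  contribution Q = floor (w (Vec.map (λ q → ι (+ p) ℚ.* q) Q)) ℤ.- floor (w Q)

  contribution≡floorDiff : ∀ Q → contribution Q ≡ floorDiff p (w Q)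
  contribution≡floorDiff Q =
    cong (λ x → floor x ℤ.- floor (w Q)) (w-map-* (ι-mono-≤ {+ 0} {+ p} (ℤ.+≤+ z≤n)) Q)

  0<D : 0 ℕ.< D
  0<D = proj₁ isD

  D*w-integral : ∀ {Q} → InM V Q → IsInt (ι (+ D) ℚ.* w Q)
  D*w-integral {Q} Q∈M = w-All (+ 0 , ℚP.*-zeroʳ (ι (+ D))) (proj₁ (proj₂ isD) Q Q∈M)

  contribution-mono-< : ∀ {x y} → InM V x → InM V y → w x ℚ.< w y → contribution x ℤ.< contribution y
  contribution-mono-< {x} {y} x∈M y∈M wx<wy rewrite contribution≡floorDiff x | contribution≡floorDiff y =
    floorDiff-mono-< 0<D 2D<p (D*w-integral x∈M) (D*w-integral y∈M) wx<wy

  contribution-mono-≤ : ∀ {x y} → InM V x → InM V y → w x ℚ.≤ w y → contribution x ℤ.≤ contribution y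
  contribution-mono-≤ {x} {y} x∈M y∈M wx≤wy rewrite contribution≡floorDiff x | contribution≡floorDiff y =
    floorDiff-mono-≤ 0<D 2D<p (D*w-integral x∈M) (D*w-integral y∈M) wx≤wy

  module Σw = Exchange ℚP.+-0-isCommutativeMonoid ℚ._≤_ ℚP.≤-refl ℚP.+-mono-≤ (w {n})
  module Σh = Exchange ℤP.+-0-isCommutativeMonoid ℤ._≤_ ℤP.≤-refl ℤP.+-mono-≤ contribution

  MinW-≤-outside : ∀ {ℓ T} → IsSubsetℓ V ℓ T → MinW V ℓ T →
                   ∀ {x y} → x ∈ T → y ∉ T → InM V y → w x ℚ.≤ w y
  MinW-≤-outside {T = T} (T-unique , T-size , T⊆M) minW {x} {y} x∈T y∉T y∈M with w x ℚP.≤? w y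
  ... | yes wx≤wy = wx≤wy
  ... | no wx≰wy  = ⊥-elim (ℚP.<-irrefl refl (ℚP.≤-<-trans (minW (y ∷ remove x T) swapped) lighter))
    where
    swapped : IsSubsetℓ V _ (y ∷ remove x T)
    swapped = (All.tabulate (λ z∈ y≡z → y∉T (subst (_∈ T) (sym y≡z) (∈-remove⁻ x∈T z∈)))
                ∷ Unique-remove x∈T T-unique)
            , ≡-trans (length-remove x∈T) T-size
            , y∈M ∷ All-remove x∈T T⊆M
    lighter : wsum (y ∷ remove x T) ℚ.< wsum T
    lighter = subst (wsum (y ∷ remove x T) ℚ.<_) (Σw.sumOf-remove x∈T)
                    (ℚP.+-monoˡ-< (wsum (remove x T)) (ℚP.≰⇒> wx≰wy))

  -- If w y < w x, minimality of both sets forces S ⊆ T, impossible as y ∈ T ∖ S and #S = #T.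
  MinW-≤-outside-of : ∀ {ℓ S T} → IsSubsetℓ V ℓ S → MinW V ℓ S → IsSubsetℓ V ℓ T → MinW V ℓ T →
                      ∀ {x y} → x ∈ T → y ∉ S → InM V y → w x ℚ.≤ w y
  MinW-≤-outside-of {S = S} {T} S-set@(S-unique , S-size , S⊆M) minS T-set@(_ , T-size , _) minT
                    {x} {y} x∈T y∉S y∈M with y ∈? T
  ... | no y∉T  = MinW-≤-outside T-set minT x∈T y∉T y∈M
  ... | yes y∈T with w x ℚP.≤? w y
  ...   | yes wx≤wy = wx≤wy
  ...   | no wx≰wy  = contradiction (≡-trans S-size (sym T-size)) (ℕP.<⇒≢ (⊑-∉⇒length-< S S⊑T y∈T y∉S))
    where
    S⊆T : ∀ {z} → z ∈ S → z ∈ T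
    S⊆T {z} z∈S with z ∈? T
    ... | yes z∈T = z∈T
    ... | no z∉T  = contradiction (ℚP.≤-trans (MinW-≤-outside T-set minT x∈T z∉T (All.lookup S⊆M z∈S))
                                              (MinW-≤-outside S-set minS z∈S y∉S y∈M)) wx≰wy
    S⊑T : S ⊑ T
    S⊑T {z} z∈S = ℕP.≤-trans (Unique⇒count≤1 S-unique z) (∈⇒0<count (S⊆T z∈S))

  module _ {ℓ m} (Ss : Vec (List (Vec ℚ n)) m) (Ss-sets : ∀ j → IsSubsetℓ V ℓ (lookup Ss j)) where

    S* : List (Vec ℚ n)
    S* = ⊎S Ss

    Ss-unique : ∀ j → Unique (lookup Ss j)
    Ss-unique j = proj₁ (Ss-sets j)

    Ss-size : ∀ j → length (lookup Ss j) ≡ ℓ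
    Ss-size j = proj₁ (proj₂ (Ss-sets j))

    S*⊆M : All (InM V) S*
    S*⊆M = All-concat-toList Ss (λ j → proj₂ (proj₂ (Ss-sets j)))

    S*-size : length S* ≡ m ℕ.* ℓ
    S*-size = length-concat-toList Ss Ss-size

    swap-InMℓm : ∀ {x y} i → x ∈ S* → y ∉ lookup Ss i → InM V y → InMℓm V ℓ m (y ∷ remove x S*)
    swap-InMℓm {x} {y} i x∈S* y∉Si y∈M =
      ≡-trans (length-remove x∈S*) S*-size , y∈M ∷ All-remove x∈S* S*⊆M , bounded
      where
      bounded : ∀ Q → count Q (y ∷ remove x S*) ≤ m
      bounded Q with ≡-dec _≟ℚ_ Q y
      ... | yes refl = ℕP.≤-<-trans (count-remove-≤ x∈S* Q) (count-concat-toList-∉ Ss Ss-unique i y∉Si)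
      ... | no _     = ℕP.≤-trans (count-remove-≤ x∈S* Q) (count-concat-toList-≤ Ss Ss-unique Q)

    MinH-≤-outside : MinH V ℓ m p S* → ∀ {x y} i → x ∈ S* → y ∉ lookup Ss i → InM V y → w x ℚ.≤ w y
    MinH-≤-outside minH {x} {y} i x∈S* y∉Si y∈M with w x ℚP.≤? w y
    ... | yes wx≤wy = wx≤wy
    ... | no wx≰wy  = contradiction (minH (y ∷ remove x S*) (swap-InMℓm i x∈S* y∉Si y∈M)) (ℤP.<⇒≱ cheaper)
      where
      cheaper : h p (y ∷ remove x S*) ℤ.< h p S*
      cheaper = subst (h p (y ∷ remove x S*) ℤ.<_) (Σh.sumOf-remove x∈S*)
        (ℤP.+-monoˡ-< (h p (remove x S*)) (contribution-mono-< y∈M (All.lookup S*⊆M x∈S*) (ℚP.≰⇒> wx≰wy)))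

    MinH⇒MinW : MinH V ℓ m p S* → ∀ i → MinW V ℓ (lookup Ss i)
    MinH⇒MinW minH i T (T-unique , T-size , T⊆M) =
      Σw.sumOf-≼ (lookup Ss i) T (≡-trans (Ss-size i) (sym T-size)) dominated
      where
      dominated : Σw.SurplusDominates (lookup Ss i) T
      dominated {x} {y} x∈Si y∈T more =
        MinH-≤-outside minH i (∈-concat-toList⁺ Ss i x∈Si) y∉Si (All.lookup T⊆M y∈T)
        where
        y∉Si : y ∉ lookup Ss i
        y∉Si y∈Si = ℕP.<⇒≱ (∈⇒0<count y∈Si) (ℕ.s≤s⁻¹ (ℕP.<-≤-trans more (Unique⇒count≤1 T-unique y)))

    MinW⇒MinH : (∀ i → MinW V ℓ (lookup Ss i)) → MinH V ℓ m p S*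
    MinW⇒MinH minW S′ (S′-size , S′⊆M , S′-bounded) =
      Σh.sumOf-≼ S* S′ (≡-trans S*-size (sym S′-size)) dominated
      where
      dominated : Σh.SurplusDominates S* S′
      dominated {x} {y} x∈S* y∈S′ more
        with i , y∉Si ← count-concat-toList-<⇒∉ Ss y (ℕP.<-≤-trans more (S′-bounded y))
           | j , x∈Sj ← ∈-concat-toList⁻ Ss x∈S* =
        contribution-mono-≤ (All.lookup S*⊆M x∈S*) (All.lookup S′⊆M y∈S′)
          (MinW-≤-outside-of (Ss-sets i) (minW i) (Ss-sets j) (minW j) x∈Sj y∉Si (All.lookup S′⊆M y∈S′))

lemma3p11 : (n : ℕ) → 1 ≤ n → (V : Vec (Vec ℤ n) n) → LinIndep V →
    (D : ℕ) → IsD V D →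
    (p : ℕ) → Prime p → ¬ (p ∣ Vol V) → (n + 4) * D < p →
    (ℓ m : ℕ) → 1 ≤ ℓ → 1 ≤ m →
    (S : Vec (List (Vec ℚ n)) m) → ((j : Fin m) → IsSubsetℓ V ℓ (lookup S j)) →
    MinH V ℓ m p (⊎S S) ⇔ ((i : Fin m) → MinW V ℓ (lookup S i))
lemma3p11 n _ V _ D isD p _ _ [n+4]D<p ℓ m _ _ S S-sets =
  mk⇔ (MinH⇒MinW isD 2D<p S S-sets) (MinW⇒MinH isD 2D<p S S-sets)
  where
  2D<p : 2 * D < p
  2D<p = ℕP.≤-<-trans (ℕP.*-monoˡ-≤ D (ℕP.≤-trans (ℕP.m≤m+n 2 2) (ℕP.m≤n+m 4 n))) [n+4]D<p
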